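{- Let $w$ be a finite word with $|\mathrm{Alph}(w)|\ge 2$. Then $|w|=R_w+K_w+|\mathrm{Alph}(w)|-2$ if and only if $w$ has exactly one right special factor of length $i$ for every integer $0\le i<R_w$, and every non-empty right special factor of $w$ has right-valence $2$.
   Context: Words are finite sequences of letters; $|w|$ is the length and $\mathrm{Alph}(w)$ the set of letters of $w$. A factor is a contiguous subword (including the empty word). A factor $u$ of $w$ has right-valence $j$ if $ux$ is a factor of $w$ for exactly $j$ distinct letters $x$; $u$ is right special if its right-valence is at least $2$. $R_w$ is the smallest positive integer $r$ such that $w$ has no right special factor of length $r$; $K_w$ is the length of the shortest suffix of $w$ occurring exactly once in $w$. -}

module Defs where

open import Data.Nat using (ℕ; _≤_; _<_)
open import Data.List using (List; []; _∷_; _++_; length; deduplicate)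
open import Data.List.Membership.Propositional using (_∈_)
open import Data.List.Relation.Unary.Unique.Propositional using (Unique)
open import Data.Product using (Σ; ∃; ∃-syntax; _×_; _,_)
open import Relation.Binary.PropositionalEquality using (_≡_; _≢_)
open import Relation.Binary.Definitions using (DecidableEquality)
open import Relation.Nullary using (¬_)
open import Function.Bundles using (_⇔_)

module _ {A : Set} where

  Factor : List A → List A → Set
  Factor u w = ∃[ p ] ∃[ s ] p ++ u ++ s ≡ w

  Suffix : List A → List A → Set
  Suffix u w = ∃[ p ] p ++ u ≡ w

  OccursOnce : List A → List A → Set
  OccursOnce u w =
    ∃[ p ] ∃[ s ] (p ++ u ++ s ≡ w) ×
      (∀ p' s' → p' ++ u ++ s' ≡ w → length p' ≡ length p)

  RightValence : List A → List A → ℕ → Set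
  RightValence w u j =
    Factor u w × ∃[ xs ] Unique xs × length xs ≡ j × (∀ x → (x ∈ xs) ⇔ Factor (u ++ x ∷ []) w)

  RightSpecial : List A → List A → Set
  RightSpecial w u =
    Factor u w × ∃[ x ] ∃[ y ] x ≢ y × Factor (u ++ x ∷ []) w × Factor (u ++ y ∷ []) w

  IsR : List A → ℕ → Set
  IsR w r =
    1 ≤ r × (∀ u → length u ≡ r → ¬ RightSpecial w u) ×
    (∀ r' → 1 ≤ r' → r' < r → ∃[ u ] length u ≡ r' × RightSpecial w u)

  IsK : List A → ℕ → Set
  IsK w k =
    (∃[ s ] Suffix s w × length s ≡ k × OccursOnce s w) ×
    (∀ s → Suffix s w → length s < k → ¬ OccursOnce s w)

alphSize : {A : Set} → DecidableEquality A → List A → ℕ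
alphSize _≟_ w = length (deduplicate _≟_ w)

module Submission where

-- Call position i of w a branching of length n if it is the first occurrence of its
-- factor of length n + 1 but not of its factor of length n, and let b(n) be their number.
-- Counting factors by first occurrences, passing from length n to n + 1 adds b(n) factors and
-- loses one exactly when the suffix of length n occurs once, which happens iff n ≥ K_w;
-- telescoping over n < |w| gives |w| = K_w + Σ_n b(n). Branchings of length n account for
-- the right special factors of length n, each counted (right-valence − 1) times. Hence
-- b(0) = |Alph(w)| − 1, b(n) ≥ 1 for 1 ≤ n < R_w and b(n) = 0 for n ≥ R_w, so
-- |w| ≥ K_w + (|Alph(w)| − 1) + (R_w − 1), with equality iff b(n) = 1 for all 1 ≤ n < R_w;
-- and b(n) ≥ 2 iff there are two right special factors of length n or one of valence ≥ 3.

open import Defs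
open import Data.Nat using (ℕ; _+_; _∸_; _≤_; _<_)
open import Data.List using (List; [])
open import Data.Product using (∃-syntax; _×_)
open import Relation.Binary.PropositionalEquality using (_≡_; _≢_)
open import Relation.Binary.Definitions using (DecidableEquality)
open import Function.Bundles using (_⇔_)

open import Data.Nat using (zero; suc; z≤n; s≤s; _≤?_; _<?_)
open import Data.Nat.Properties
open import Data.Nat.Tactic.RingSolver using (solve-∀)
open import Data.List using (_∷_; _++_; length; take; drop; filter; deduplicate)
import Data.List.Properties as List
open import Data.List.Properties
  using (length-++; length-take; length-drop; take++drop≡id; ++-identityʳ; ++-assoc;
         filter-accept; filter-reject)
open import Data.List.Membership.Propositional using (_∈_)
open import Data.List.Relation.Unary.Any using (here; there)
open import Data.List.Relation.Unary.All using (All; []; _∷_; all?)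
open import Data.List.Relation.Unary.AllPairs using ([]; _∷_)
open import Data.Maybe using (Maybe; just; nothing)
import Data.Maybe.Properties as Maybe
import Data.Maybe.Relation.Unary.All as MaybeAll
open import Data.Product using (_,_; proj₁; proj₂)
open import Data.Sum using (_⊎_; inj₁; inj₂)
open import Data.Empty using (⊥; ⊥-elim)
open import Relation.Nullary using (¬_; Dec; yes; no)
open import Relation.Nullary.Decidable using (map′; _×-dec_; ¬?)
open import Relation.Binary.PropositionalEquality
  using (refl; sym; trans; cong; cong₂; subst; subst₂; module ≡-Reasoning)
open import Relation.Binary.Definitions using (tri<; tri≈; tri>)
open import Algebra.Properties.CommutativeSemigroup +-commutativeSemigroup using (interchange)
open import Function using (_∘_)
open import Function.Bundles using (mk⇔; Equivalence)

module Counting where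

  ⟦_⟧ : {P : Set} → Dec P → ℕ
  ⟦ yes _ ⟧ = 1
  ⟦ no _ ⟧ = 0

  sumTo : (ℕ → ℕ) → ℕ → ℕ
  sumTo g zero = 0
  sumTo g (suc m) = sumTo g m + g m

  count : {P : ℕ → Set} → (∀ i → Dec (P i)) → ℕ → ℕ
  count d = sumTo (λ i → ⟦ d i ⟧)

  ⟦⟧-yes : {P : Set} (d : Dec P) → P → ⟦ d ⟧ ≡ 1
  ⟦⟧-yes (yes _) _ = refl
  ⟦⟧-yes (no ¬p) p = ⊥-elim (¬p p)

  ⟦⟧-no : {P : Set} (d : Dec P) → ¬ P → ⟦ d ⟧ ≡ 0
  ⟦⟧-no (yes p) ¬p = ⊥-elim (¬p p)
  ⟦⟧-no (no _) _ = refl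

  ⟦⟧-cong : {P Q : Set} (d : Dec P) (e : Dec Q) → (P → Q) → (Q → P) → ⟦ d ⟧ ≡ ⟦ e ⟧
  ⟦⟧-cong (yes p) e f g = sym (⟦⟧-yes e (f p))
  ⟦⟧-cong (no ¬p) e f g = sym (⟦⟧-no e (λ q → ¬p (g q)))

  ⟦⟧-split : {P Q : Set} (d : Dec P) (e : Dec Q) (dq : Dec (P × Q)) (dn : Dec (P × ¬ Q)) →
    ⟦ d ⟧ ≡ ⟦ dq ⟧ + ⟦ dn ⟧
  ⟦⟧-split (yes p) (yes q) dq dn
    rewrite ⟦⟧-yes dq (p , q) | ⟦⟧-no dn (λ x → proj₂ x q) = refl
  ⟦⟧-split (yes p) (no ¬q) dq dn
    rewrite ⟦⟧-no dq (λ x → ¬q (proj₂ x)) | ⟦⟧-yes dn (p , ¬q) = refl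
  ⟦⟧-split (no ¬p) e dq dn
    rewrite ⟦⟧-no dq (λ x → ¬p (proj₁ x)) | ⟦⟧-no dn (λ x → ¬p (proj₁ x)) = refl

  sumTo-ext : (g h : ℕ → ℕ) (m : ℕ) → (∀ i → i < m → g i ≡ h i) → sumTo g m ≡ sumTo h m
  sumTo-ext g h zero eq = refl
  sumTo-ext g h (suc m) eq =
    cong₂ _+_ (sumTo-ext g h m (λ i i<m → eq i (m<n⇒m<1+n i<m))) (eq m ≤-refl)

  sumTo-+ : (g h : ℕ → ℕ) (m : ℕ) → sumTo (λ i → g i + h i) m ≡ sumTo g m + sumTo h m
  sumTo-+ g h zero = refl
  sumTo-+ g h (suc m) =
    trans (cong (_+ (g m + h m)) (sumTo-+ g h m)) (interchange (sumTo g m) (sumTo h m) (g m) (h m))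

  sumTo-mono : (g h : ℕ → ℕ) (m : ℕ) → (∀ i → i < m → g i ≤ h i) → sumTo g m ≤ sumTo h m
  sumTo-mono g h zero le = z≤n
  sumTo-mono g h (suc m) le =
    +-mono-≤ (sumTo-mono g h m (λ i i<m → le i (m<n⇒m<1+n i<m))) (le m ≤-refl)

  sumTo-vanish : (g : ℕ → ℕ) (a : ℕ) → (∀ i → a ≤ i → g i ≡ 0) → ∀ e → sumTo g (a + e) ≡ sumTo g a
  sumTo-vanish g a vanish zero = cong (sumTo g) (+-identityʳ a)
  sumTo-vanish g a vanish (suc e) rewrite +-suc a e | sumTo-vanish g a vanish e
    | vanish (a + e) (m≤m+n a e) = +-identityʳ _

  sumTo-cutoff : (g : ℕ → ℕ) (a b : ℕ) → (∀ i → a ≤ i → g i ≡ 0) → (∀ i → b ≤ i → g i ≡ 0) →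
    sumTo g a ≡ sumTo g b
  sumTo-cutoff g a b va vb with ≤-total a b
  ... | inj₁ a≤b = trans (sym (sumTo-vanish g a va (b ∸ a))) (cong (sumTo g) (m+[n∸m]≡n a≤b))
  ... | inj₂ b≤a = trans (cong (sumTo g) (sym (m+[n∸m]≡n b≤a))) (sumTo-vanish g b vb (a ∸ b))

  squeeze : ∀ {a b c d} → a ≤ b → c ≤ d → b + d ≤ a + c → a ≡ b × c ≡ d
  squeeze {a} {b} {c} {d} a≤b c≤d tight = a≡b , ≤-antisym c≤d (+-cancelˡ-≤ b d c b+d≤b+c)
    where
    a≡b : a ≡ b
    a≡b = ≤-antisym a≤b (+-cancelʳ-≤ d b a (≤-trans tight (+-monoʳ-≤ a c≤d)))
    b+d≤b+c : b + d ≤ b + c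
    b+d≤b+c = subst (λ z → b + d ≤ z + c) a≡b tight

  sumTo-tight : (g h : ℕ → ℕ) (m : ℕ) → (∀ i → i < m → g i ≤ h i) → sumTo h m ≤ sumTo g m →
    ∀ i → i < m → g i ≡ h i
  sumTo-tight g h (suc m) le tight i i<1+m =
    split (m<1+n⇒m<n∨m≡n i<1+m) (squeeze (sumTo-mono g h m le′) (le m ≤-refl) tight)
    where
    le′ : ∀ i → i < m → g i ≤ h i
    le′ i i<m = le i (m<n⇒m<1+n i<m)
    split : i < m ⊎ i ≡ m → sumTo g m ≡ sumTo h m × g m ≡ h m → g i ≡ h i
    split (inj₁ i<m) (sums≡ , _) = sumTo-tight g h m le′ (≤-reflexive (sym sums≡)) i i<m
    split (inj₂ refl) (_ , last≡) = last≡

  count-ext : {P Q : ℕ → Set} (d : ∀ i → Dec (P i)) (e : ∀ i → Dec (Q i)) (m : ℕ) →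
    (∀ i → i < m → P i → Q i) → (∀ i → i < m → Q i → P i) → count d m ≡ count e m
  count-ext d e m f g = sumTo-ext _ _ m (λ i i<m → ⟦⟧-cong (d i) (e i) (f i i<m) (g i i<m))

  count-split : {P Q : ℕ → Set} (d : ∀ i → Dec (P i)) (e : ∀ i → Dec (Q i))
    (dq : ∀ i → Dec (P i × Q i)) (dn : ∀ i → Dec (P i × ¬ Q i)) (m : ℕ) →
    count d m ≡ count dq m + count dn m
  count-split d e dq dn m =
    trans (sumTo-ext _ _ m (λ i _ → ⟦⟧-split (d i) (e i) (dq i) (dn i)))
          (sumTo-+ (λ i → ⟦ dq i ⟧) (λ i → ⟦ dn i ⟧) m)

  count-none : {P : ℕ → Set} (d : ∀ i → Dec (P i)) (m : ℕ) → (∀ i → i < m → ¬ P i) → count d m ≡ 0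
  count-none d zero none = refl
  count-none d (suc m) none
    rewrite count-none d m (λ i i<m → none i (m<n⇒m<1+n i<m)) | ⟦⟧-no (d m) (none m ≤-refl) = refl

  count-shift : {P : ℕ → Set} (d : ∀ i → Dec (P i)) (m : ℕ) →
    count d (suc m) ≡ ⟦ d 0 ⟧ + count (λ i → d (suc i)) m
  count-shift d zero = sym (+-identityʳ _)
  count-shift d (suc m) rewrite count-shift d m = +-assoc ⟦ d 0 ⟧ _ _

  count-≥1 : {P : ℕ → Set} (d : ∀ i → Dec (P i)) (m i : ℕ) → i < m → P i → 1 ≤ count d m
  count-≥1 d (suc m) i i<1+m p with m<1+n⇒m<n∨m≡n i<1+m
  ... | inj₁ i<m = ≤-trans (count-≥1 d m i i<m p) (m≤m+n _ _)
  ... | inj₂ refl rewrite ⟦⟧-yes (d i) p = m≤n+m 1 _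

  count-≥2-ordered : {P : ℕ → Set} (d : ∀ i → Dec (P i)) (m i j : ℕ) → i < j → j < m →
    P i → P j → 2 ≤ count d m
  count-≥2-ordered d (suc m) i j i<j j<1+m pi pj with m<1+n⇒m<n∨m≡n j<1+m
  ... | inj₁ j<m = ≤-trans (count-≥2-ordered d m i j i<j j<m pi pj) (m≤m+n _ _)
  ... | inj₂ refl rewrite ⟦⟧-yes (d j) pj = +-monoˡ-≤ 1 (count-≥1 d j i i<j pi)

  count-≥2 : {P : ℕ → Set} (d : ∀ i → Dec (P i)) (m i j : ℕ) → i ≢ j → i < m → j < m →
    P i → P j → 2 ≤ count d m
  count-≥2 d m i j i≢j i<m j<m pi pj with <-cmp i j
  ... | tri< i<j _ _ = count-≥2-ordered d m i j i<j j<m pi pj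
  ... | tri≈ _ i≡j _ = ⊥-elim (i≢j i≡j)
  ... | tri> _ _ j<i = count-≥2-ordered d m j i j<i i<m pj pi

  count-≥1-inv : {P : ℕ → Set} (d : ∀ i → Dec (P i)) (m : ℕ) → 1 ≤ count d m → ∃[ i ] i < m × P i
  count-≥1-inv d (suc m) pos with d m
  ... | yes pm = m , ≤-refl , pm
  ... | no _ rewrite +-identityʳ (count d m) =
    let (i , i<m , pi) = count-≥1-inv d m pos in i , m<n⇒m<1+n i<m , pi

  count-≥2-inv : {P : ℕ → Set} (d : ∀ i → Dec (P i)) (m : ℕ) → 2 ≤ count d m →
    ∃[ i ] ∃[ j ] i < j × j < m × P i × P j
  count-≥2-inv d (suc m) two with d m
  ... | yes pm =
    let (i , i<m , pi) = count-≥1-inv d m (≤-pred (subst (2 ≤_) (+-comm (count d m) 1) two))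
    in i , m , i<m , ≤-refl , pi , pm
  ... | no _ rewrite +-identityʳ (count d m) =
    let (i , j , i<j , j<m , pi , pj) = count-≥2-inv d m two
    in i , j , i<j , m<n⇒m<1+n j<m , pi , pj

  count-threshold : {P : ℕ → Set} (d : ∀ i → Dec (P i)) (L K : ℕ) →
    (∀ n → n < L → P n → K ≤ n) → (∀ n → n < L → K ≤ n → P n) → K ≤ L → count d L ≡ L ∸ K
  count-threshold d zero .zero below above z≤n = refl
  count-threshold d (suc L) K below above K≤1+L with m≤n⇒m<n∨m≡n K≤1+L
  ... | inj₂ refl =
    trans (count-none d (suc L) (λ i i<K p → <⇒≱ i<K (below i i<K p))) (sym (n∸n≡0 (suc L)))
  ... | inj₁ (s≤s K≤L)
    rewrite count-threshold d L K (λ n n<L → below n (m<n⇒m<1+n n<L))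
                                  (λ n n<L → above n (m<n⇒m<1+n n<L)) K≤L
          | ⟦⟧-yes (d L) (above L ≤-refl K≤L) = trans (+-comm (L ∸ K) 1) (sym (+-∸-assoc 1 K≤L))

  all<? : {P : ℕ → Set} → (∀ t → Dec (P t)) → ∀ n → Dec (∀ t → t < n → P t)
  all<? d n = map′ (λ all t → all {t}) (λ all {t} → all t) (allUpTo? d n)

  leastBelow : {P : ℕ → Set} (d : ∀ i → Dec (P i)) (n : ℕ) → ∃[ k ] k < n × P k →
    ∃[ j ] j < n × P j × (∀ i → i < j → ¬ P i)
  leastBelow d (suc n) (k , k<1+n , pk) with anyUpTo? d n
  ... | yes below = let (j , j<n , pj , min) = leastBelow d n below in j , m<n⇒m<1+n j<n , pj , min
  ... | no none = k , k<1+n , pk , λ i i<k pi → none (i , <-≤-trans i<k (≤-pred k<1+n) , pi)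

  least : {P : ℕ → Set} (d : ∀ i → Dec (P i)) (a : ℕ) → P a →
    ∃[ j ] j ≤ a × P j × (∀ i → i < j → ¬ P i)
  least d a pa = let (j , j<1+a , pj , min) = leastBelow d (suc a) (a , ≤-refl , pa) in
    j , ≤-pred j<1+a , pj , min

module Positions {A : Set} where

  at : List A → ℕ → Maybe A
  at [] _ = nothing
  at (x ∷ xs) zero = just x
  at (x ∷ xs) (suc t) = at xs t

  at-ext : (xs ys : List A) → (∀ t → at xs t ≡ at ys t) → xs ≡ ys
  at-ext [] [] same = refl
  at-ext [] (y ∷ ys) same with same 0
  ... | ()
  at-ext (x ∷ xs) [] same with same 0
  ... | ()
  at-ext (x ∷ xs) (y ∷ ys) same with same 0
  ... | refl = cong (x ∷_) (at-ext xs ys (λ t → same (suc t)))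

  at-beyond : (xs : List A) (t : ℕ) → length xs ≤ t → at xs t ≡ nothing
  at-beyond [] t _ = refl
  at-beyond (x ∷ xs) (suc t) (s≤s h) = at-beyond xs t h

  at-within : (xs : List A) (t : ℕ) → t < length xs → ∃[ x ] at xs t ≡ just x
  at-within (x ∷ xs) zero _ = x , refl
  at-within (x ∷ xs) (suc t) (s≤s h) = at-within xs t h

  at-just⇒< : (xs : List A) (t : ℕ) {x : A} → at xs t ≡ just x → t < length xs
  at-just⇒< (y ∷ xs) zero _ = s≤s z≤n
  at-just⇒< (y ∷ xs) (suc t) e = s≤s (at-just⇒< xs t e)

  at-++ˡ : (xs ys : List A) (t : ℕ) → t < length xs → at (xs ++ ys) t ≡ at xs t
  at-++ˡ (x ∷ xs) ys zero _ = refl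
  at-++ˡ (x ∷ xs) ys (suc t) (s≤s h) = at-++ˡ xs ys t h

  at-++ʳ : (xs ys : List A) (t : ℕ) → at (xs ++ ys) (length xs + t) ≡ at ys t
  at-++ʳ [] ys t = refl
  at-++ʳ (x ∷ xs) ys t = at-++ʳ xs ys t

  at-snoc : (u : List A) (x : A) (t : ℕ) →
    (t < length u × at (u ++ x ∷ []) t ≡ at u t) ⊎
    (t ≡ length u × at (u ++ x ∷ []) t ≡ just x) ⊎
    (suc (length u) ≤ t × at (u ++ x ∷ []) t ≡ nothing)
  at-snoc [] x zero = inj₂ (inj₁ (refl , refl))
  at-snoc [] x (suc t) = inj₂ (inj₂ (s≤s z≤n , refl))
  at-snoc (y ∷ u) x zero = inj₁ (s≤s z≤n , refl)
  at-snoc (y ∷ u) x (suc t) with at-snoc u x t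
  ... | inj₁ (a , b) = inj₁ (s≤s a , b)
  ... | inj₂ (inj₁ (a , b)) = inj₂ (inj₁ (cong suc a , b))
  ... | inj₂ (inj₂ (a , b)) = inj₂ (inj₂ (s≤s a , b))

  at-drop : (v : List A) (i t : ℕ) → at (drop i v) t ≡ at v (i + t)
  at-drop v zero t = refl
  at-drop [] (suc i) t = refl
  at-drop (x ∷ v) (suc i) t = at-drop v i t

  at-take : (v : List A) (n t : ℕ) → t < n → at (take n v) t ≡ at v t
  at-take [] (suc n) t _ = refl
  at-take (x ∷ v) (suc n) zero _ = refl
  at-take (x ∷ v) (suc n) (suc t) (s≤s h) = at-take v n t h

  at-take-beyond : (v : List A) (n t : ℕ) → n ≤ t → at (take n v) t ≡ nothing
  at-take-beyond v zero t _ = refl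
  at-take-beyond [] (suc n) t _ = refl
  at-take-beyond (x ∷ v) (suc n) (suc t) (s≤s h) = at-take-beyond v n t h

  window : List A → ℕ → ℕ → List A
  window v i n = take n (drop i v)

  at-window : (v : List A) (i n t : ℕ) → t < n → at (window v i n) t ≡ at v (i + t)
  at-window v i n t t<n = trans (at-take (drop i v) n t t<n) (at-drop v i t)

  at-window-beyond : (v : List A) (i n t : ℕ) → n ≤ t → at (window v i n) t ≡ nothing
  at-window-beyond v i n t = at-take-beyond (drop i v) n t

  length-window : (v : List A) (i n : ℕ) → i + n ≤ length v → length (window v i n) ≡ n
  length-window v i n fits = trans (length-take n (drop i v)) (m≤n⇒m⊓n≡m n≤rest)
    where
    n≤rest : n ≤ length (drop i v)
    n≤rest = subst (n ≤_) (sym (length-drop i v))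
      (subst (_≤ length v ∸ i) (m+n∸m≡n i n) (∸-monoˡ-≤ i fits))

  window-factor : (v : List A) (i n : ℕ) → Factor (window v i n) v
  window-factor v i n = take i v , drop n (drop i v) ,
    trans (cong (take i v ++_) (take++drop≡id n (drop i v))) (take++drop≡id i v)

  factor-position : (u v : List A) → Factor u v →
    ∃[ i ] i + length u ≤ length v × (∀ t → t < length u → at v (i + t) ≡ at u t)
  factor-position u v (p , s , p++u++s≡v) = length p , fits , letters
    where
    fits : length p + length u ≤ length v
    fits = subst (λ z → length p + length u ≤ length z) p++u++s≡v
      (subst (length p + length u ≤_) (sym (trans (length-++ p) (cong (length p +_) (length-++ u))))
        (+-monoʳ-≤ (length p) (m≤m+n (length u) (length s))))
    letters : ∀ t → t < length u → at v (length p + t) ≡ at u t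
    letters t t<u = trans (cong (λ z → at z (length p + t)) (sym p++u++s≡v))
      (trans (at-++ʳ p (u ++ s) t) (at-++ˡ u s t t<u))

open Counting
open Positions

module FactorCounting {A : Set} (_≟_ : DecidableEquality A) (w : List A) where

  L : ℕ
  L = length w

  -- The windows of length n at positions j and i of w agree (past the end both read nothing).
  Agree : ℕ → ℕ → ℕ → Set
  Agree j i n = ∀ t → t < n → at w (j + t) ≡ at w (i + t)

  agree? : ∀ j i n → Dec (Agree j i n)
  agree? j i n = all<? (λ t → Maybe.≡-dec _≟_ (at w (j + t)) (at w (i + t))) n

  agree-refl : ∀ i n → Agree i i n
  agree-refl i n t _ = refl

  agree-sym : ∀ {j i n} → Agree j i n → Agree i j n
  agree-sym e t t<n = sym (e t t<n)

  agree-trans : ∀ {a b c n} → Agree a b n → Agree b c n → Agree a c n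
  agree-trans e₁ e₂ t t<n = trans (e₁ t t<n) (e₂ t t<n)

  agree-prefix : ∀ {j i n} → Agree j i (suc n) → Agree j i n
  agree-prefix e t t<n = e t (m<n⇒m<1+n t<n)

  agree-last : ∀ {j i n} → Agree j i (suc n) → at w (j + n) ≡ at w (i + n)
  agree-last e = e _ ≤-refl

  agree-extend : ∀ {j i n} → Agree j i n → at w (j + n) ≡ at w (i + n) → Agree j i (suc n)
  agree-extend {n = n} e last t t<1+n with m<1+n⇒m<n∨m≡n t<1+n
  ... | inj₁ t<n = e t t<n
  ... | inj₂ refl = last

  Fresh : ℕ → ℕ → Set
  Fresh n i = ∀ j → j < i → ¬ Agree j i n

  fresh? : ∀ n i → Dec (Fresh n i)
  fresh? n i = all<? (λ j → ¬? (agree? j i n)) i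

  fresh-suc : ∀ {n i} → Fresh n i → Fresh (suc n) i
  fresh-suc fresh j j<i e = fresh j j<i (agree-prefix e)

  -- Position i is a first occurrence of its window of length n + 1 but not of its
  -- window of length n: it extends an earlier factor of length n by a new letter.
  Branch : ℕ → ℕ → Set
  Branch n i = Fresh (suc n) i × ¬ Fresh n i

  branch? : ∀ n i → Dec (Branch n i)
  branch? n i = fresh? (suc n) i ×-dec ¬? (fresh? n i)

  -- The number of distinct factors of length n (one per first occurrence).
  distinct : ℕ → ℕ
  distinct n = count (fresh? n) (suc (L ∸ n))

  -- The number of branchings at length n: the sum over right special factors u of
  -- length n of (right-valence of u) − 1.
  branchings : ℕ → ℕ
  branchings n = count (branch? n) (L ∸ n)

  -- 1 if the suffix of length n occurs only once in w, else 0.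
  suffixOnce : ℕ → ℕ
  suffixOnce n = ⟦ fresh? n (L ∸ n) ⟧

  -- Extending factors by one letter: distinct (n + 1) = distinct n + branchings n,
  -- except that the suffix of length n loses its extension when it occurs once.
  distinct-step : ∀ n → n < L → distinct (suc n) + suffixOnce n ≡ distinct n + branchings n
  distinct-step n n<L =
    begin
      count (fresh? (suc n)) (suc (L ∸ suc n)) + ⟦ fresh? n M ⟧
    ≡⟨ cong (λ z → count (fresh? (suc n)) z + ⟦ fresh? n M ⟧) (sym (+-∸-assoc 1 n<L)) ⟩
      count (fresh? (suc n)) M + ⟦ fresh? n M ⟧
    ≡⟨ cong (_+ ⟦ fresh? n M ⟧) (count-split (fresh? (suc n)) (fresh? n) both (branch? n) M) ⟩
      (count both M + branchings n) + ⟦ fresh? n M ⟧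
    ≡⟨ cong (λ z → (z + branchings n) + ⟦ fresh? n M ⟧) fresh-both ⟩
      (count (fresh? n) M + branchings n) + ⟦ fresh? n M ⟧
    ≡⟨ +-assoc (count (fresh? n) M) (branchings n) _ ⟩
      count (fresh? n) M + (branchings n + ⟦ fresh? n M ⟧)
    ≡⟨ cong (count (fresh? n) M +_) (+-comm (branchings n) _) ⟩
      count (fresh? n) M + (⟦ fresh? n M ⟧ + branchings n)
    ≡⟨ sym (+-assoc (count (fresh? n) M) _ (branchings n)) ⟩
      distinct n + branchings n
    ∎
    where
    open ≡-Reasoning
    M : ℕ
    M = L ∸ n
    both : ∀ i → Dec (Fresh (suc n) i × Fresh n i)
    both i = fresh? (suc n) i ×-dec fresh? n i
    fresh-both : count both M ≡ count (fresh? n) M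
    fresh-both = count-ext both (fresh? n) M (λ _ _ → proj₂) (λ _ _ f → fresh-suc f , f)

  distinct-0 : distinct 0 ≡ 1
  distinct-0 = trans (count-shift (fresh? 0) L)
    (cong₂ _+_ (⟦⟧-yes (fresh? 0 0) (λ j ()))
               (count-none (λ i → fresh? 0 (suc i)) L (λ i _ fresh → fresh 0 (s≤s z≤n) (λ t ()))))

  distinct-L : distinct L ≡ 1
  distinct-L rewrite n∸n≡0 L = ⟦⟧-yes (fresh? L 0) (λ j ())

  telescope : ∀ n → n ≤ L → distinct n + sumTo suffixOnce n ≡ 1 + sumTo branchings n
  telescope zero _ = trans (+-identityʳ (distinct 0)) distinct-0
  telescope (suc n) n<L =
    begin
      distinct (suc n) + (sumTo suffixOnce n + suffixOnce n)
    ≡⟨ cong (distinct (suc n) +_) (+-comm (sumTo suffixOnce n) (suffixOnce n)) ⟩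
      distinct (suc n) + (suffixOnce n + sumTo suffixOnce n)
    ≡⟨ sym (+-assoc (distinct (suc n)) (suffixOnce n) _) ⟩
      (distinct (suc n) + suffixOnce n) + sumTo suffixOnce n
    ≡⟨ cong (_+ sumTo suffixOnce n) (distinct-step n n<L) ⟩
      (distinct n + branchings n) + sumTo suffixOnce n
    ≡⟨ +-assoc (distinct n) (branchings n) _ ⟩
      distinct n + (branchings n + sumTo suffixOnce n)
    ≡⟨ cong (distinct n +_) (+-comm (branchings n) _) ⟩
      distinct n + (sumTo suffixOnce n + branchings n)
    ≡⟨ sym (+-assoc (distinct n) _ (branchings n)) ⟩
      (distinct n + sumTo suffixOnce n) + branchings n
    ≡⟨ cong (_+ branchings n) (telescope n (<⇒≤ n<L)) ⟩
      1 + sumTo branchings n + branchings n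
    ∎
    where open ≡-Reasoning

  suffixOnce≡branchings : sumTo suffixOnce L ≡ sumTo branchings L
  suffixOnce≡branchings =
    suc-injective (trans (cong (_+ sumTo suffixOnce L) (sym distinct-L)) (telescope L ≤-refl))

-- The number of lengths whose suffix occurs only once is L − K_w, so L = K_w + Σ branchings.
module UniqueSuffix {A : Set} (_≟_ : DecidableEquality A) (w : List A) (k : ℕ) (isK : IsK w k) where
  open FactorCounting _≟_ w

  private
    s : List A
    s = proj₁ (proj₁ isK)
    p : List A
    p = proj₁ (proj₁ (proj₂ (proj₁ isK)))
    p++s≡w : p ++ s ≡ w
    p++s≡w = proj₂ (proj₁ (proj₂ (proj₁ isK)))
    |s|≡k : length s ≡ k
    |s|≡k = proj₁ (proj₂ (proj₂ (proj₁ isK)))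
    s-once : OccursOnce s w
    s-once = proj₂ (proj₂ (proj₂ (proj₁ isK)))
    s-once-position : ∀ p′ s′ → p′ ++ s ++ s′ ≡ w → length p′ ≡ length (proj₁ s-once)
    s-once-position = proj₂ (proj₂ (proj₂ s-once))
    shorter-not-once : ∀ u → Suffix u w → length u < k → ¬ OccursOnce u w
    shorter-not-once = proj₂ isK

  |p|+k≡L : length p + k ≡ L
  |p|+k≡L = trans (cong (length p +_) (sym |s|≡k)) (trans (sym (length-++ p)) (cong length p++s≡w))

  k≤L : k ≤ L
  k≤L = subst (k ≤_) |p|+k≡L (m≤n+m k (length p))

  |p|≡L∸k : length p ≡ L ∸ k
  |p|≡L∸k = trans (sym (m+n∸n≡m (length p) k)) (cong (_∸ k) |p|+k≡L)

  s-only-at-end : ∀ p′ s′ → p′ ++ s ++ s′ ≡ w → length p′ ≡ L ∸ k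
  s-only-at-end p′ s′ e = trans (s-once-position p′ s′ e)
    (trans (sym (s-once-position p [] (trans (cong (p ++_) (++-identityʳ s)) p++s≡w))) |p|≡L∸k)

  at-s : ∀ t → at s t ≡ at w (L ∸ k + t)
  at-s t = trans (sym (at-++ʳ p s t))
    (trans (cong (λ z → at z (length p + t)) p++s≡w) (cong (λ z → at w (z + t)) |p|≡L∸k))

  -- If the suffix of length n occurs first at its end position, it occurs once, so n ≥ k.
  fresh-suffix⇒k≤ : ∀ n → n < L → Fresh n (L ∸ n) → k ≤ n
  fresh-suffix⇒k≤ n n<L fresh with k ≤? n
  ... | yes k≤n = k≤n
  ... | no k≰n = ⊥-elim (shorter-not-once u (take (L ∸ n) w , take++drop≡id (L ∸ n) w)
                           (subst (_< k) (sym |u|≡n) (≰⇒> k≰n)) u-once)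
    where
    u : List A
    u = drop (L ∸ n) w
    |u|≡n : length u ≡ n
    |u|≡n = trans (length-drop (L ∸ n) w) (m∸[m∸n]≡n (<⇒≤ n<L))
    occurrence-at-end : ∀ p′ s′ → p′ ++ u ++ s′ ≡ w → length p′ ≡ L ∸ n
    occurrence-at-end p′ s′ e with <-cmp (length p′) (L ∸ n)
    ... | tri≈ _ i≡ _ = i≡
    ... | tri< i< _ _ = ⊥-elim (fresh (length p′) i< (λ t t<n →
            trans (letters t (subst (t <_) (sym |u|≡n) t<n)) (at-drop w (L ∸ n) t)))
      where
      letters : ∀ t → t < length u → at w (length p′ + t) ≡ at u t
      letters = proj₂ (proj₂ (factor-position u w (p′ , s′ , e)))
    ... | tri> _ _ >i = ⊥-elim (<⇒≱ (subst (_< length p′ + n) (m∸n+n≡m (<⇒≤ n<L)) (+-monoˡ-< n >i))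
                                     (subst (λ z → length p′ + z ≤ L) |u|≡n fits))
      where
      fits : length p′ + length u ≤ L
      fits = proj₁ (proj₂ (factor-position u w (p′ , s′ , e)))
    u-once : OccursOnce u w
    u-once = take (L ∸ n) w , [] ,
      trans (cong (take (L ∸ n) w ++_) (++-identityʳ u)) (take++drop≡id (L ∸ n) w) ,
      λ p′ s′ e → trans (occurrence-at-end p′ s′ e) (sym (length-window w 0 (L ∸ n) (m∸n≤m L n)))

  -- If n ≥ k, an earlier occurrence of the suffix of length n would give an earlier
  -- occurrence of s.
  k≤⇒fresh-suffix : ∀ n → n < L → k ≤ n → Fresh n (L ∸ n)
  k≤⇒fresh-suffix n n<L k≤n j j<L∸n agree =
    <⇒≢ q<L∸k (trans (sym (length-window w 0 q q≤L)) (s-only-at-end (take q w) _ s-at-q))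
    where
    d : ℕ
    d = n ∸ k
    L∸k≡ : L ∸ k ≡ (L ∸ n) + d
    L∸k≡ = begin
      L ∸ k                     ≡⟨ cong (_∸ k) (sym (m∸n+n≡m (<⇒≤ n<L))) ⟩
      (L ∸ n) + n ∸ k           ≡⟨ +-∸-assoc (L ∸ n) k≤n ⟩
      (L ∸ n) + d               ∎
      where open ≡-Reasoning
    q : ℕ
    q = j + d
    q<L∸k : q < L ∸ k
    q<L∸k = subst (q <_) (sym L∸k≡) (+-monoˡ-< d j<L∸n)
    q≤L : q ≤ L
    q≤L = ≤-trans (<⇒≤ q<L∸k) (m∸n≤m L k)
    s≡window : s ≡ window w q k
    s≡window = at-ext s (window w q k) letters
      where
      letters : ∀ t → at s t ≡ at (window w q k) t
      letters t with t <? k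
      ... | yes t<k = begin
            at s t                        ≡⟨ at-s t ⟩
            at w (L ∸ k + t)              ≡⟨ cong (λ z → at w (z + t)) L∸k≡ ⟩
            at w ((L ∸ n) + d + t)        ≡⟨ cong (at w) (+-assoc (L ∸ n) d t) ⟩
            at w ((L ∸ n) + (d + t))      ≡⟨ sym (agree (d + t) d+t<n) ⟩
            at w (j + (d + t))            ≡⟨ cong (at w) (sym (+-assoc j d t)) ⟩
            at w (q + t)                  ≡⟨ sym (at-window w q k t t<k) ⟩
            at (window w q k) t           ∎
        where
        open ≡-Reasoning
        d+t<n : d + t < n
        d+t<n = subst (d + t <_) (m∸n+n≡m k≤n) (+-monoʳ-< d t<k)
      ... | no t≮k = trans (at-beyond s t (subst (_≤ t) (sym |s|≡k) (≮⇒≥ t≮k)))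
                           (sym (at-window-beyond w q k t (≮⇒≥ t≮k)))
    s-at-q : take q w ++ s ++ drop k (drop q w) ≡ w
    s-at-q = subst (λ z → take q w ++ z ++ drop k (drop q w) ≡ w) (sym s≡window)
                   (proj₂ (proj₂ (window-factor w q k)))

  length≡k+branchings : L ≡ k + sumTo branchings L
  length≡k+branchings =
    trans (sym (m+[n∸m]≡n k≤L)) (cong (k +_) (trans (sym once-count) suffixOnce≡branchings))
    where
    once-count : sumTo suffixOnce L ≡ L ∸ k
    once-count = count-threshold (λ n → fresh? n (L ∸ n)) L k fresh-suffix⇒k≤ k≤⇒fresh-suffix k≤L

+<⇒<∸ : ∀ {x n M} → x + n < M → x < M ∸ n
+<⇒<∸ {x} = m+n≤o⇒m≤o∸n (suc x)

<∸⇒+< : ∀ {x n M} → x < M ∸ n → x + n < M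
<∸⇒+< {x} {n} {M} x<M∸n = m≤o∸n⇒m+n≤o (suc x) (<⇒≤ (m∸n≢0⇒n<m M∸n≢0)) x<M∸n
  where
  M∸n≢0 : M ∸ n ≢ 0
  M∸n≢0 M∸n≡0 = n≮0 (subst (x <_) M∸n≡0 x<M∸n)

-- Branchings of length n correspond to right special factors of length n: each right
-- special factor yields one branching per extension beyond the first.
module RightSpecialBranchings {A : Set} (_≟_ : DecidableEquality A) (w : List A) where
  open FactorCounting _≟_ w

  OccursAt : ℕ → List A → Set
  OccursAt i u = ∀ t → t < length u → at w (i + t) ≡ at u t

  occursAt-unique : ∀ i u v → OccursAt i u → OccursAt i v → length u ≡ length v → u ≡ v
  occursAt-unique i u v u-at-i v-at-i |u|≡|v| = at-ext u v letters
    where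
    letters : ∀ t → at u t ≡ at v t
    letters t with t <? length u
    ... | yes t<u = trans (sym (u-at-i t t<u)) (v-at-i t (subst (t <_) |u|≡|v| t<u))
    ... | no t≮u = trans (at-beyond u t (≮⇒≥ t≮u)) (sym (at-beyond v t (subst (_≤ t) |u|≡|v| (≮⇒≥ t≮u))))

  occursAt-agree : ∀ a b u → OccursAt a u → OccursAt b u → Agree a b (length u)
  occursAt-agree a b u u-at-a u-at-b t t<u = trans (u-at-a t t<u) (sym (u-at-b t t<u))

  agree-occursAt : ∀ a b u → Agree a b (length u) → OccursAt b u → OccursAt a u
  agree-occursAt a b u agree u-at-b t t<u = trans (agree t t<u) (u-at-b t t<u)

  extension-position : ∀ u z → Factor (u ++ z ∷ []) w → ∃[ c ] OccursAt c u × at w (c + length u) ≡ just z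
  extension-position u z uz-factor = c , u-at-c , z-after
    where
    c : ℕ
    c = proj₁ (factor-position (u ++ z ∷ []) w uz-factor)
    uz-at-c : ∀ t → t < length (u ++ z ∷ []) → at w (c + t) ≡ at (u ++ z ∷ []) t
    uz-at-c = proj₂ (proj₂ (factor-position (u ++ z ∷ []) w uz-factor))
    |uz| : length (u ++ z ∷ []) ≡ length u + 1
    |uz| = length-++ u
    u-at-c : OccursAt c u
    u-at-c t t<u = trans (uz-at-c t (subst (t <_) (sym |uz|) (≤-trans t<u (m≤m+n (length u) 1))))
                      (at-++ˡ u (z ∷ []) t t<u)
    z-after : at w (c + length u) ≡ just z
    z-after = trans (cong (λ q → at w (c + q)) (sym (+-identityʳ (length u))))
      (trans (uz-at-c (length u + 0) (subst (length u + 0 <_) (sym |uz|) (+-monoʳ-< (length u) (s≤s z≤n))))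
             (at-++ʳ u (z ∷ []) 0))

  first-occurrence : ∀ n a → ∃[ j ] j ≤ a × Agree j a n × Fresh n j
  first-occurrence n a with least (λ j → agree? j a n) a (agree-refl a n)
  ... | (j , j≤a , j~a , earlier) = j , j≤a , j~a , λ i i<j i~j → earlier i i<j (agree-trans i~j j~a)

  position-bound : ∀ {c′ c n z} → c′ ≤ c → at w (c + n) ≡ just z → c′ < L ∸ n
  position-bound {c′} {c} {n} c′≤c cz = +<⇒<∸ (≤-<-trans (+-monoˡ-≤ n c′≤c) (at-just⇒< w (c + n) cz))

  -- Two occurrences of a factor of length n followed by different letters x ≠ y: the first
  -- occurrence of the later-occurring of the two extensions is a branching, followed by x or y.
  branch-between : ∀ n a b {x y} → Agree a b n → at w (a + n) ≡ just x → at w (b + n) ≡ just y →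
    x ≢ y → ∃[ i ] i < L ∸ n × Branch n i × Agree i a n × (at w (i + n) ≡ just x ⊎ at w (i + n) ≡ just y)
  branch-between n a b a~b ax by x≢y with first-occurrence (suc n) a | first-occurrence (suc n) b
  ... | (a′ , a′≤a , a′~a , fresh-a′) | (b′ , b′≤b , b′~b , fresh-b′) with <-cmp a′ b′
  ... | tri< a′<b′ _ _ =
    b′ , position-bound b′≤b by , (fresh-b′ , λ fresh → fresh a′ a′<b′ a′~b′) ,
    agree-trans (agree-prefix b′~b) (agree-sym a~b) , inj₂ (trans (agree-last b′~b) by)
    where
    a′~b′ : Agree a′ b′ n
    a′~b′ = agree-trans (agree-prefix a′~a) (agree-trans a~b (agree-sym (agree-prefix b′~b)))
  ... | tri≈ _ refl _ = ⊥-elim (x≢y (Maybe.just-injective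
    (trans (sym ax) (trans (sym (agree-last a′~a)) (trans (agree-last b′~b) by)))))
  ... | tri> _ _ b′<a′ =
    a′ , position-bound a′≤a ax , (fresh-a′ , λ fresh → fresh b′ b′<a′ b′~a′) ,
    agree-prefix a′~a , inj₁ (trans (agree-last a′~a) ax)
    where
    b′~a′ : Agree b′ a′ n
    b′~a′ = agree-trans (agree-prefix b′~b) (agree-trans (agree-sym a~b) (agree-sym (agree-prefix a′~a)))

  rs⇒branch : ∀ u → RightSpecial w u → ∃[ i ] i < L ∸ length u × Branch (length u) i × OccursAt i u
  rs⇒branch u (_ , x , y , x≢y , ux , uy) with extension-position u x ux | extension-position u y uy
  ... | (a , u-at-a , ax) | (b , u-at-b , by)
    with branch-between (length u) a b (occursAt-agree a b u u-at-a u-at-b) ax by x≢y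
  ... | (i , i< , branch , i~a , _) = i , i< , branch , agree-occursAt i a u i~a u-at-a

  two-rs⇒branchings≥2 : ∀ u v → length u ≡ length v → RightSpecial w u → RightSpecial w v → u ≢ v →
    2 ≤ branchings (length u)
  two-rs⇒branchings≥2 u v |u|≡|v| u-rs v-rs u≢v with rs⇒branch u u-rs | rs⇒branch v v-rs
  ... | (i , i< , i-branch , u-at-i) | (j , j< , j-branch , v-at-j) =
    count-≥2 (branch? (length u)) _ i j (λ { refl → u≢v (occursAt-unique i u v u-at-i v-at-j |u|≡|v|) })
      i< (subst (λ m → j < L ∸ m) (sym |u|≡|v|) j<) i-branch (subst (λ m → Branch m j) (sym |u|≡|v|) j-branch)

  separated-branchings≥2 : ∀ n i j {x y} → i < L ∸ n → j < L ∸ n → Branch n i → Branch n j →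
    at w (i + n) ≡ just x → at w (j + n) ≡ just y → x ≢ y → 2 ≤ branchings n
  separated-branchings≥2 n i j i< j< i-branch j-branch ix jy x≢y =
    count-≥2 (branch? n) _ i j (λ { refl → x≢y (Maybe.just-injective (trans (sym ix) jy)) })
      i< j< i-branch j-branch

  three-extensions⇒branchings≥2 : ∀ u x y z → Factor (u ++ x ∷ []) w → Factor (u ++ y ∷ []) w →
    Factor (u ++ z ∷ []) w → x ≢ y → y ≢ z → x ≢ z → 2 ≤ branchings (length u)
  three-extensions⇒branchings≥2 u x y z ux uy uz x≢y y≢z x≢z
    with extension-position u x ux | extension-position u y uy | extension-position u z uz
  ... | (a , u-at-a , ax) | (b , u-at-b , by) | (c , u-at-c , cz)
    with branch-between (length u) a b (occursAt-agree a b u u-at-a u-at-b) ax by x≢y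
       | branch-between (length u) b c (occursAt-agree b c u u-at-b u-at-c) by cz y≢z
       | branch-between (length u) a c (occursAt-agree a c u u-at-a u-at-c) ax cz x≢z
  ... | (i , i< , bi , _ , inj₁ ix) | (j , j< , bj , _ , inj₁ jy) | _ =
    separated-branchings≥2 _ i j i< j< bi bj ix jy x≢y
  ... | (i , i< , bi , _ , inj₁ ix) | (j , j< , bj , _ , inj₂ jz) | _ =
    separated-branchings≥2 _ i j i< j< bi bj ix jz x≢z
  ... | (i , i< , bi , _ , inj₂ iy) | _ | (j , j< , bj , _ , inj₁ jx) =
    separated-branchings≥2 _ i j i< j< bi bj iy jx (λ y≡x → x≢y (sym y≡x))
  ... | (i , i< , bi , _ , inj₂ iy) | _ | (j , j< , bj , _ , inj₂ jz) =
    separated-branchings≥2 _ i j i< j< bi bj iy jz y≢z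

  branch-witness : ∀ n i → Branch n i → ∃[ j ] j < i × Agree j i n × at w (j + n) ≢ at w (i + n)
  branch-witness n i (fresh-1+n , not-fresh-n) with anyUpTo? (λ j → agree? j i n) i
  ... | no none = ⊥-elim (not-fresh-n (λ j j<i j~i → none (j , j<i , j~i)))
  ... | yes (j , j<i , j~i) = j , j<i , j~i , λ same → fresh-1+n j j<i (agree-extend j~i same)

  extension-factor : ∀ p i n x → i + n ≤ L → Agree p i n → at w (p + n) ≡ just x →
    Factor (window w i n ++ x ∷ []) w
  extension-factor p i n x fits p~i px = subst (λ z → Factor z w) extended (window-factor w p (suc n))
    where
    |window| : length (window w i n) ≡ n
    |window| = length-window w i n fits
    extended : window w p (suc n) ≡ window w i n ++ x ∷ []
    extended = at-ext _ _ letters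
      where
      letters : ∀ t → at (window w p (suc n)) t ≡ at (window w i n ++ x ∷ []) t
      letters t with at-snoc (window w i n) x t
      ... | inj₁ (t<|window| , e) =
        trans (at-window w p (suc n) t (m<n⇒m<1+n t<n))
          (trans (p~i t t<n) (trans (sym (at-window w i n t t<n)) (sym e)))
        where
        t<n : t < n
        t<n = subst (t <_) |window| t<|window|
      ... | inj₂ (inj₁ (refl , e)) =
        trans (at-window w p (suc n) t (subst (_< suc n) (sym |window|) ≤-refl))
          (trans (subst (λ m → at w (p + m) ≡ just x) (sym |window|) px) (sym e))
      ... | inj₂ (inj₂ (beyond , e)) =
        trans (at-window-beyond w p (suc n) t (subst (λ m → suc m ≤ t) |window| beyond)) (sym e)

  branch⇒rs : ∀ n i → i < L ∸ n → Branch n i → RightSpecial w (window w i n)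
  branch⇒rs n i i< branch with branch-witness n i branch
  ... | (j , j<i , j~i , differ)
    with at-within w (j + n) (<-trans (+-monoˡ-< n j<i) (<∸⇒+< i<)) | at-within w (i + n) (<∸⇒+< i<)
  ... | (x , jx) | (y , iy) =
    window-factor w i n , x , y , (λ { refl → differ (trans jx (sym iy)) }) ,
    extension-factor j i n x fits j~i jx , extension-factor i i n y fits (agree-refl i n) iy
    where
    fits : i + n ≤ L
    fits = <⇒≤ (<∸⇒+< i<)

  branchings≥2⇒ : ∀ n → 2 ≤ branchings n →
    (∃[ u ] ∃[ v ] length u ≡ n × length v ≡ n × RightSpecial w u × RightSpecial w v × u ≢ v) ⊎
    (∃[ u ] ∃[ x ] ∃[ y ] ∃[ z ] length u ≡ n ×
       Factor (u ++ x ∷ []) w × Factor (u ++ y ∷ []) w × Factor (u ++ z ∷ []) w × x ≢ y × y ≢ z × x ≢ z)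
  branchings≥2⇒ n two with count-≥2-inv (branch? n) (L ∸ n) two
  ... | (i , i′ , i<i′ , i′< , i-branch , i′-branch) with agree? i i′ n
  ... | no i≁i′ =
    inj₁ (window w i n , window w i′ n , length-window w i n (fits i<) , length-window w i′ n (fits i′<) ,
          branch⇒rs n i i< i-branch , branch⇒rs n i′ i′< i′-branch ,
          λ same → i≁i′ (λ t t<n → trans (sym (at-window w i n t t<n))
                          (trans (cong (λ z → at z t) same) (at-window w i′ n t t<n))))
    where
    i< : i < L ∸ n
    i< = <-trans i<i′ i′<
    fits : ∀ {c} → c < L ∸ n → c + n ≤ L
    fits c< = <⇒≤ (<∸⇒+< c<)
  ... | yes i~i′ with branch-witness n i i-branch
  ... | (j , j<i , j~i , j≠i) with at-within w (j + n) (<-trans (+-monoˡ-< n j<i) (in<L))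
                                 | at-within w (i + n) in<L | at-within w (i′ + n) (<∸⇒+< i′<)
    where
    in<L : i + n < L
    in<L = <-trans (+-monoˡ-< n i<i′) (<∸⇒+< i′<)
  ... | (x , jx) | (y , iy) | (z , i′z) =
    inj₂ (window w i n , x , y , z , length-window w i n fits ,
          extension-factor j i n x fits j~i jx , extension-factor i i n y fits (agree-refl i n) iy ,
          extension-factor i′ i n z fits (agree-sym i~i′) i′z ,
          (λ { refl → j≠i (trans jx (sym iy)) }) ,
          (λ { refl → proj₁ i′-branch i i<i′ (agree-extend i~i′ (trans iy (sym i′z))) }) ,
          (λ { refl → proj₁ i′-branch j (<-trans j<i i<i′)
                        (agree-extend (agree-trans j~i i~i′) (trans jx (sym i′z))) }))
    where
    fits : i + n ≤ L
    fits = <⇒≤ (<-trans (+-monoˡ-< n i<i′) (<∸⇒+< i′<))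

module _ {A : Set} {w : List A} where

  factor-suffix : ∀ a c → Factor (a ++ c) w → Factor c w
  factor-suffix a c (p , s , e) = p ++ a , s ,
    trans (++-assoc p a (c ++ s)) (trans (cong (p ++_) (sym (++-assoc a c s))) e)

  factor-prefix : ∀ u c → Factor (u ++ c) w → Factor u w
  factor-prefix u c (p , s , e) = p , c ++ s , trans (cong (p ++_) (sym (++-assoc u c s))) e

  factor-snoc-suffix : ∀ a b x → Factor ((a ++ b) ++ x ∷ []) w → Factor (b ++ x ∷ []) w
  factor-snoc-suffix a b x abx =
    factor-suffix a (b ++ x ∷ []) (subst (λ z → Factor z w) (++-assoc a b (x ∷ [])) abx)

  rs-suffix : ∀ a b → RightSpecial w (a ++ b) → RightSpecial w b
  rs-suffix a b (ab , x , y , x≢y , abx , aby) =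
    factor-suffix a b ab , x , y , x≢y , factor-snoc-suffix a b x abx , factor-snoc-suffix a b y aby

  rs-shorter : ∀ u m → m ≤ length u → RightSpecial w u → ∃[ v ] length v ≡ m × RightSpecial w v
  rs-shorter u m m≤u u-rs = drop (length u ∸ m) u ,
    trans (length-drop (length u ∸ m) u) (m∸[m∸n]≡n m≤u) ,
    rs-suffix (take (length u ∸ m) u) _ (subst (RightSpecial w) (sym (take++drop≡id (length u ∸ m) u)) u-rs)

module BranchingsAndR {A : Set} (_≟_ : DecidableEquality A) (w : List A) (r : ℕ) (isR : IsR w r) where
  open FactorCounting _≟_ w
  open RightSpecialBranchings _≟_ w

  -- Right special factors are shorter than r, since suffixes of them would have length r.
  rs-length<r : ∀ u → RightSpecial w u → length u < r
  rs-length<r u u-rs with length u <? r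
  ... | yes u<r = u<r
  ... | no u≮r = let (v , |v|≡r , v-rs) = rs-shorter u r (≮⇒≥ u≮r) u-rs in
    ⊥-elim (proj₁ (proj₂ isR) v |v|≡r v-rs)

  -- Branchings of length n ≥ r would give right special factors of length ≥ r.
  branchings-from-r : ∀ n → r ≤ n → branchings n ≡ 0
  branchings-from-r n r≤n = count-none (branch? n) (L ∸ n) λ i i< branch →
    <⇒≱ (rs-length<r (window w i n) (branch⇒rs n i i< branch))
        (subst (r ≤_) (sym (length-window w i n (<⇒≤ (<∸⇒+< i<)))) r≤n)

  branchings-from-L : ∀ n → L ≤ n → branchings n ≡ 0
  branchings-from-L n L≤n rewrite m≤n⇒m∸n≡0 L≤n = refl

  branchings-below-r : ∀ n → 1 ≤ n → n < r → 1 ≤ branchings n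
  branchings-below-r n 1≤n n<r with proj₂ (proj₂ isR) n 1≤n n<r
  ... | (u , refl , u-rs) with rs⇒branch u u-rs
  ... | (i , i< , branch , _) = count-≥1 (branch? (length u)) (L ∸ length u) i i< branch

  sum-to-r : sumTo branchings L ≡ sumTo branchings r
  sum-to-r = sumTo-cutoff branchings L r branchings-from-L branchings-from-r

-- |Alph(v)| counts the positions holding the first occurrence of their letter.
module Alphabet {A : Set} (_≟_ : DecidableEquality A) where

  removeAll : List A → List A → List A
  removeAll [] ys = ys
  removeAll (e ∷ ex) ys = removeAll ex (filter (¬? ∘ (e ≟_)) ys)

  Avoids : List A → A → Set
  Avoids ex a = All (_≢ a) ex

  avoids? : ∀ ex a → Dec (Avoids ex a)
  avoids? ex a = all? (λ e → ¬? (e ≟ a)) ex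

  removeAll-[] : ∀ ex → removeAll ex [] ≡ []
  removeAll-[] [] = refl
  removeAll-[] (e ∷ ex) = removeAll-[] ex

  length-removeAll-∷ : ∀ ex c ys →
    length (removeAll ex (c ∷ ys)) ≡ ⟦ avoids? ex c ⟧ + length (removeAll ex ys)
  length-removeAll-∷ [] c ys = refl
  length-removeAll-∷ (e ∷ ex) c ys = by-cases (e ≟ c)
    where
    by-cases : Dec (e ≡ c) →
      length (removeAll (e ∷ ex) (c ∷ ys)) ≡ ⟦ avoids? (e ∷ ex) c ⟧ + length (removeAll (e ∷ ex) ys)
    by-cases (yes e≡c) =
      trans (cong (length ∘ removeAll ex) (filter-reject (¬? ∘ (e ≟_)) (λ e≢c → e≢c e≡c)))
            (cong (_+ _) (sym (⟦⟧-no (avoids? (e ∷ ex) c) (λ { (e≢c ∷ _) → e≢c e≡c }))))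
    by-cases (no e≢c) =
      trans (cong (length ∘ removeAll ex) (filter-accept (¬? ∘ (e ≟_)) e≢c))
        (trans (length-removeAll-∷ ex c _)
          (cong (_+ _) (⟦⟧-cong (avoids? ex c) (avoids? (e ∷ ex) c) (e≢c ∷_) (λ { (_ ∷ avoid) → avoid }))))

  NewLetter : List A → List A → ℕ → Set
  NewLetter v ex i = (∀ j → j < i → at v j ≢ at v i) × MaybeAll.All (Avoids ex) (at v i)

  newLetter? : ∀ v ex i → Dec (NewLetter v ex i)
  newLetter? v ex i =
    all<? (λ j → ¬? (Maybe.≡-dec _≟_ (at v j) (at v i))) i ×-dec MaybeAll.dec (avoids? ex) (at v i)

  avoids-∷ : ∀ c ex m → just c ≢ m → MaybeAll.All (Avoids ex) m → MaybeAll.All (Avoids (c ∷ ex)) m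
  avoids-∷ c ex nothing _ _ = MaybeAll.nothing
  avoids-∷ c ex (just a) c≢a (MaybeAll.just avoid) = MaybeAll.just ((λ c≡a → c≢a (cong just c≡a)) ∷ avoid)

  avoids-∷⁻ : ∀ c ex m → MaybeAll.All (Avoids (c ∷ ex)) m → just c ≢ m × MaybeAll.All (Avoids ex) m
  avoids-∷⁻ c ex nothing _ = (λ ()) , MaybeAll.nothing
  avoids-∷⁻ c ex (just a) (MaybeAll.just (c≢a ∷ avoid)) =
    (λ c≡a → c≢a (Maybe.just-injective c≡a)) , MaybeAll.just avoid

  newLetter-∷ : ∀ c v ex i → NewLetter (c ∷ v) ex (suc i) → NewLetter v (c ∷ ex) i
  newLetter-∷ c v ex i (first , avoid) =
    (λ j j<i → first (suc j) (s≤s j<i)) , avoids-∷ c ex (at v i) (first 0 (s≤s z≤n)) avoid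

  newLetter-∷⁻ : ∀ c v ex i → NewLetter v (c ∷ ex) i → NewLetter (c ∷ v) ex (suc i)
  newLetter-∷⁻ c v ex i (first , avoid) = first′ , proj₂ (avoids-∷⁻ c ex (at v i) avoid)
    where
    first′ : ∀ j → j < suc i → at (c ∷ v) j ≢ at v i
    first′ zero _ = proj₁ (avoids-∷⁻ c ex (at v i) avoid)
    first′ (suc j) (s≤s j<i) = first j j<i

  count-newLetters : ∀ v ex → count (newLetter? v ex) (length v) ≡ length (removeAll ex (deduplicate _≟_ v))
  count-newLetters [] ex = sym (cong length (removeAll-[] ex))
  count-newLetters (c ∷ v) ex = begin
    count (newLetter? (c ∷ v) ex) (suc (length v))
      ≡⟨ count-shift (newLetter? (c ∷ v) ex) (length v) ⟩
    ⟦ newLetter? (c ∷ v) ex 0 ⟧ + count (λ i → newLetter? (c ∷ v) ex (suc i)) (length v)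
      ≡⟨ cong₂ _+_ (⟦⟧-cong (newLetter? (c ∷ v) ex 0) (avoids? ex c) (λ { (_ , MaybeAll.just avoid) → avoid })
                                                             (λ avoid → (λ j ()) , MaybeAll.just avoid))
                   (count-ext _ (newLetter? v (c ∷ ex)) (length v)
                      (λ i _ → newLetter-∷ c v ex i) (λ i _ → newLetter-∷⁻ c v ex i)) ⟩
    ⟦ avoids? ex c ⟧ + count (newLetter? v (c ∷ ex)) (length v)
      ≡⟨ cong (⟦ avoids? ex c ⟧ +_) (count-newLetters v (c ∷ ex)) ⟩
    ⟦ avoids? ex c ⟧ + length (removeAll (c ∷ ex) (deduplicate _≟_ v))
      ≡⟨ sym (length-removeAll-∷ ex c _) ⟩
    length (removeAll ex (deduplicate _≟_ (c ∷ v))) ∎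
    where open ≡-Reasoning

module AlphabetAndBranchings {A : Set} (_≟_ : DecidableEquality A) (w : List A) where
  open FactorCounting _≟_ w
  open Alphabet _≟_

  private
    avoids-nothing : ∀ m → MaybeAll.All (Avoids []) m
    avoids-nothing nothing = MaybeAll.nothing
    avoids-nothing (just _) = MaybeAll.just []

    agree-1⇒same : ∀ j i → Agree j i 1 → at w j ≡ at w i
    agree-1⇒same j i j~i = subst₂ (λ a b → at w a ≡ at w b) (+-identityʳ j) (+-identityʳ i) (j~i 0 (s≤s z≤n))

    same⇒agree-1 : ∀ j i → at w j ≡ at w i → Agree j i 1
    same⇒agree-1 j i same zero _ =
      subst₂ (λ a b → at w a ≡ at w b) (sym (+-identityʳ j)) (sym (+-identityʳ i)) same
    same⇒agree-1 j i same (suc t) (s≤s ())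

  distinct-1 : 1 ≤ L → distinct 1 ≡ alphSize _≟_ w
  distinct-1 1≤L = trans (cong (count (fresh? 1)) (m+[n∸m]≡n 1≤L))
    (trans (count-ext (fresh? 1) (newLetter? w []) L
              (λ i _ fresh → (λ j j<i same → fresh j j<i (same⇒agree-1 j i same)) , avoids-nothing (at w i))
              (λ i _ new j j<i j~i → proj₁ new j j<i (agree-1⇒same j i j~i)))
           (count-newLetters w []))

  -- The empty word has |Alph(w)| right extensions: 1 + branchings 0 = |Alph(w)|.
  branchings-0 : 1 ≤ L → 1 + branchings 0 ≡ alphSize _≟_ w
  branchings-0 1≤L = begin
    1 + branchings 0                ≡⟨ cong (_+ branchings 0) (sym distinct-0) ⟩
    distinct 0 + branchings 0       ≡⟨ sym (distinct-step 0 1≤L) ⟩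
    distinct 1 + suffixOnce 0       ≡⟨ cong (distinct 1 +_) (⟦⟧-no (fresh? 0 L) (λ fresh → fresh 0 1≤L (λ t ()))) ⟩
    distinct 1 + 0                  ≡⟨ +-identityʳ (distinct 1) ⟩
    distinct 1                      ≡⟨ distinct-1 1≤L ⟩
    alphSize _≟_ w                  ∎
    where open ≡-Reasoning

pigeonhole : {A : Set} {x y z : A} (xs : List A) → length xs ≡ 2 → x ∈ xs → y ∈ xs → z ∈ xs →
  x ≢ y → y ≢ z → x ≢ z → ⊥
pigeonhole (a ∷ b ∷ []) _ (here refl) (here refl) _ x≢y _ _ = x≢y refl
pigeonhole (a ∷ b ∷ []) _ (there (here refl)) (there (here refl)) _ x≢y _ _ = x≢y refl
pigeonhole (a ∷ b ∷ []) _ (here refl) (there (here refl)) (here refl) _ _ x≢z = x≢z refl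
pigeonhole (a ∷ b ∷ []) _ (here refl) (there (here refl)) (there (here refl)) _ y≢z _ = y≢z refl
pigeonhole (a ∷ b ∷ []) _ (there (here refl)) (here refl) (here refl) _ y≢z _ = y≢z refl
pigeonhole (a ∷ b ∷ []) _ (there (here refl)) (here refl) (there (here refl)) _ _ x≢z = x≢z refl

one≱two : ∀ {n} → n ≡ 1 → ¬ 2 ≤ n
one≱two refl (s≤s ())

alph≥1⇒length≥1 : {A : Set} (_≟_ : DecidableEquality A) (w : List A) → 1 ≤ alphSize _≟_ w → 1 ≤ length w
alph≥1⇒length≥1 _≟_ (_ ∷ _) _ = s≤s z≤n

bound-rearranged : ∀ r k α → 1 ≤ r → 2 ≤ α → r + k + α ∸ 2 ≡ k + ((α ∸ 1) + (r ∸ 1))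
bound-rearranged (suc r) k (suc (suc α)) _ _ = cong (_∸ 2) (rearrange r k α)
  where
  rearrange : ∀ r k α → suc r + k + suc (suc α) ≡ 2 + (k + (suc α + r))
  rearrange = solve-∀
bound-rearranged (suc r) k (suc zero) _ (s≤s ())

module Setting {A : Set} (_≟_ : DecidableEquality A) (w : List A) (r k : ℕ)
  (alph≥2 : 2 ≤ alphSize _≟_ w) (isR : IsR w r) (isK : IsK w k) where
  open FactorCounting _≟_ w
  open RightSpecialBranchings _≟_ w
  open BranchingsAndR _≟_ w r isR
  open UniqueSuffix _≟_ w k isK using (length≡k+branchings)
  open AlphabetAndBranchings _≟_ w using (branchings-0)

  α : ℕ
  α = alphSize _≟_ w

  1≤L : 1 ≤ L
  1≤L = alph≥1⇒length≥1 _≟_ w (≤-trans (s≤s z≤n) alph≥2)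

  1≤r : 1 ≤ r
  1≤r = proj₁ isR

  -- The least possible number of branchings: α − 1 at length 0 and 1 at each length 1, …, r − 1.
  baseline : ℕ → ℕ
  baseline zero = α ∸ 1
  baseline (suc _) = 1

  baseline≤branchings : ∀ n → n < r → baseline n ≤ branchings n
  baseline≤branchings zero _ = ≤-reflexive (cong (_∸ 1) (sym (branchings-0 1≤L)))
  baseline≤branchings (suc n) n<r = branchings-below-r (suc n) (s≤s z≤n) n<r

  length≡k+Σbranchings : L ≡ k + sumTo branchings r
  length≡k+Σbranchings = trans length≡k+branchings (cong (k +_) sum-to-r)

  bound≡k+Σbaseline : r + k + α ∸ 2 ≡ k + sumTo baseline r
  bound≡k+Σbaseline = begin
    r + k + α ∸ 2                       ≡⟨ bound-rearranged r k α 1≤r alph≥2 ⟩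
    k + ((α ∸ 1) + (r ∸ 1))             ≡⟨ cong (k +_) (sym (Σbaseline (r ∸ 1))) ⟩
    k + sumTo baseline (suc (r ∸ 1))    ≡⟨ cong (λ m → k + sumTo baseline m) (m+[n∸m]≡n 1≤r) ⟩
    k + sumTo baseline r                ∎
    where
    open ≡-Reasoning
    Σbaseline : ∀ m → sumTo baseline (suc m) ≡ (α ∸ 1) + m
    Σbaseline zero = sym (+-identityʳ (α ∸ 1))
    Σbaseline (suc m) =
      trans (cong (_+ 1) (Σbaseline m)) (trans (+-assoc (α ∸ 1) m 1) (cong ((α ∸ 1) +_) (+-comm m 1)))

  UniqueRS : Set
  UniqueRS = ∀ i → i < r → ∃[ u ] (length u ≡ i × RightSpecial w u ×
               (∀ v → length v ≡ i → RightSpecial w v → v ≡ u))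

  ValenceTwo : Set
  ValenceTwo = ∀ u → RightSpecial w u → u ≢ [] → RightValence w u 2

  -- Since α ≥ 2 there is a branching of length 0, so the empty word is right special.
  empty-rs : RightSpecial w []
  empty-rs with count-≥1-inv (branch? 0) (L ∸ 0) (+-cancelˡ-≤ 1 1 (branchings 0) two≤1+b₀)
    where
    two≤1+b₀ : 2 ≤ 1 + branchings 0
    two≤1+b₀ = subst (2 ≤_) (sym (branchings-0 1≤L)) alph≥2
  ... | (i , i< , branch) = branch⇒rs 0 i i< branch

  conditions-of-tight : (∀ n → n < r → baseline n ≡ branchings n) → UniqueRS × ValenceTwo
  conditions-of-tight tight = unique , valence-two
    where
    one-branching : ∀ u → RightSpecial w u → u ≢ [] → branchings (length u) ≡ 1
    one-branching [] _ u≢[] = ⊥-elim (u≢[] refl)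
    one-branching u@(_ ∷ _) u-rs _ = sym (tight (length u) (rs-length<r u u-rs))

    unique : UniqueRS
    unique zero _ = [] , refl , empty-rs , λ { [] _ _ → refl }
    unique (suc i) i<r with proj₂ (proj₂ isR) (suc i) (s≤s z≤n) i<r
    ... | (u , |u|≡ , u-rs) = u , |u|≡ , u-rs , only-u
      where
      only-u : ∀ v → length v ≡ suc i → RightSpecial w v → v ≡ u
      only-u v |v|≡ v-rs with List.≡-dec _≟_ v u
      ... | yes v≡u = v≡u
      ... | no v≢u = ⊥-elim (one≱two (one-branching v v-rs (λ { refl → 0≢1+n |v|≡ }))
                             (two-rs⇒branchings≥2 v u (trans |v|≡ (sym |u|≡)) v-rs u-rs v≢u))

    valence-two : ValenceTwo
    valence-two u u-rs@(u-factor , x , y , x≢y , ux , uy) u≢[] =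
      u-factor , x ∷ y ∷ [] , (x≢y ∷ []) ∷ [] ∷ [] , refl , λ z → mk⇔ (extends z) (listed z)
      where
      extends : ∀ z → z ∈ x ∷ y ∷ [] → Factor (u ++ z ∷ []) w
      extends z (here refl) = ux
      extends z (there (here refl)) = uy
      listed : ∀ z → Factor (u ++ z ∷ []) w → z ∈ x ∷ y ∷ []
      listed z uz with z ≟ x | z ≟ y
      ... | yes z≡x | _ = here z≡x
      ... | no _ | yes z≡y = there (here z≡y)
      ... | no z≢x | no z≢y = ⊥-elim (one≱two (one-branching u u-rs u≢[])
          (three-extensions⇒branchings≥2 u x y z ux uy uz x≢y (z≢y ∘ sym) (z≢x ∘ sym)))

  no-three-extensions : ValenceTwo → ∀ u x y z → u ≢ [] →
    Factor (u ++ x ∷ []) w → Factor (u ++ y ∷ []) w → Factor (u ++ z ∷ []) w → x ≢ y → y ≢ z → x ≢ z → ⊥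
  no-three-extensions valence-two u x y z u≢[] ux uy uz x≢y y≢z x≢z
    with valence-two u (factor-prefix u (x ∷ []) ux , x , y , x≢y , ux , uy) u≢[]
  ... | (_ , xs , _ , |xs| , listed) =
    pigeonhole xs |xs| (from x ux) (from y uy) (from z uz) x≢y y≢z x≢z
    where
    from : ∀ c → Factor (u ++ c ∷ []) w → c ∈ xs
    from c = Equivalence.from (listed c)

  tight-of-conditions : UniqueRS × ValenceTwo → ∀ n → n < r → baseline n ≡ branchings n
  tight-of-conditions _ zero _ = cong (_∸ 1) (sym (branchings-0 1≤L))
  tight-of-conditions (unique , valence-two) (suc n) n<r =
    ≤-antisym (branchings-below-r (suc n) (s≤s z≤n) n<r) at-most-one
    where
    at-most-one : branchings (suc n) ≤ 1
    at-most-one with 2 ≤? branchings (suc n)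
    ... | no ≱2 = ≤-pred (≰⇒> ≱2)
    ... | yes ≥2 with branchings≥2⇒ (suc n) ≥2
    ... | inj₁ (u , v , |u| , |v| , u-rs , v-rs , u≢v) =
      let (_ , _ , _ , only) = unique (suc n) n<r in
      ⊥-elim (u≢v (trans (only u |u| u-rs) (sym (only v |v| v-rs))))
    ... | inj₂ (u , x , y , z , |u| , ux , uy , uz , x≢y , y≢z , x≢z) =
      ⊥-elim (no-three-extensions valence-two u x y z (λ { refl → 0≢1+n |u| }) ux uy uz x≢y y≢z x≢z)

proposition2p4 : {A : Set} (_≟_ : DecidableEquality A) (w : List A) (r k : ℕ) →
    2 ≤ alphSize _≟_ w → IsR w r → IsK w k →
    (Data.List.length w ≡ r + k + alphSize _≟_ w ∸ 2) ⇔
    ((∀ i → i < r → ∃[ u ] (Data.List.length u ≡ i × RightSpecial w u ×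
        (∀ v → Data.List.length v ≡ i → RightSpecial w v → v ≡ u))) ×
     (∀ u → RightSpecial w u → u ≢ [] → RightValence w u 2))
proposition2p4 _≟_ w r k alph≥2 isR isK = mk⇔ conditions-of-length length-of-conditions
  where
  open Setting _≟_ w r k alph≥2 isR isK
  open FactorCounting _≟_ w using (L; branchings)

  -- |w| attains the bound iff Σ branchings equals Σ baseline, i.e. (as branchings ≥ baseline)
  -- iff the two agree at every length below r.
  conditions-of-length : L ≡ r + k + α ∸ 2 → UniqueRS × ValenceTwo
  conditions-of-length |w|≡bound = conditions-of-tight
    (sumTo-tight baseline branchings r baseline≤branchings (≤-reflexive Σ≡))
    where
    Σ≡ : sumTo branchings r ≡ sumTo baseline r
    Σ≡ = +-cancelˡ-≡ k _ _ (trans (sym length≡k+Σbranchings) (trans |w|≡bound bound≡k+Σbaseline))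

  length-of-conditions : UniqueRS × ValenceTwo → L ≡ r + k + α ∸ 2
  length-of-conditions conditions = begin
    L                          ≡⟨ length≡k+Σbranchings ⟩
    k + sumTo branchings r     ≡⟨ cong (k +_) (sumTo-ext branchings baseline r branchings≡baseline) ⟩
    k + sumTo baseline r       ≡⟨ sym bound≡k+Σbaseline ⟩
    r + k + α ∸ 2              ∎
    where
    open ≡-Reasoning
    branchings≡baseline : ∀ n → n < r → branchings n ≡ baseline n
    branchings≡baseline n n<r = sym (tight-of-conditions conditions n n<r)
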